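{- Let $\mathcal I=(\mathit{Sign},\mathit{Sen},\mathit{Mod},\models)$ be a $\frac32$-institution and let $i\in\{w,s\}$, where in the case $i=w$ we assume $\mathit{Sen}$ is oplax. Define $\mathcal I_i$ by: its $\frac32$-category of signatures is $\mathit{Th}^{\mathcal I}_i$ (theories with weak, resp. strong, theory morphisms, order and composition inherited from $\mathit{Sign}$); $\mathit{Sen}_i(\Sigma,E)=\mathit{Sen}(\Sigma)$ and $\mathit{Sen}_i(\varphi)=\mathit{Sen}(\varphi)$; $\mathit{Mod}_i(\Sigma,E)$ is the full subcategory of $\mathit{Mod}(\Sigma)$ of the models satisfying $E$, and for a theory morphism $\varphi:(\Sigma,E)\to(\Sigma',E')$ and a $(\Sigma',E')$-model $M'$, $\mathit{Mod}_i(\varphi)M'=\{M\in\mathit{Mod}(\varphi)M'\mid M\models E\}$; satisfaction is inherited from $\mathcal I$. Then $\mathcal I_i$ is a $\frac32$-institution.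
   Context: A $\frac32$-institution $(\mathit{Sign},\mathit{Sen},\mathit{Mod},\models)$: a category $\mathit{Sign}$ with partially ordered hom-sets and monotone (diagrammatic) composition; for each signature $\Sigma$ a set $\mathit{Sen}(\Sigma)$ and for each $\varphi:\Sigma\to\Sigma'$ a partial function $\mathit{Sen}(\varphi):\mathit{Sen}(\Sigma)\rightharpoonup\mathit{Sen}(\Sigma')$, monotone in $\varphi$ (graph inclusion) and either lax ($\mathit{Sen}(\varphi);\mathit{Sen}(\varphi')\subseteq\mathit{Sen}(\varphi;\varphi')$, $1\subseteq\mathit{Sen}(1_\Sigma)$) or oplax (reverse inclusions); for each $\Sigma$ a category $\mathit{Mod}(\Sigma)$ and for each $\varphi:\Sigma\to\Sigma'$ a lax functor from $\mathit{Mod}(\Sigma')$ to the power category of $\mathit{Mod}(\Sigma)$ (objects sets of objects, arrows sets of arrows composed pairwise), assigning each $\Sigma'$-model $M'$ a set $\mathit{Mod}(\varphi)M'$ of $\Sigma$-models, with $\varphi\le\theta\Rightarrow\mathit{Mod}(\theta)M'\subseteq\mathit{Mod}(\varphi)M'$, $\bigcup_{M'\in\mathit{Mod}(\varphi')M''}\mathit{Mod}(\varphi)M'\subseteq\mathit{Mod}(\varphi;\varphi')M''$, $M\in\mathit{Mod}(1_\Sigma)M$; satisfaction relations $\models_\Sigma$ with the Satisfaction Condition ($M'\models\mathit{Sen}(\varphi)\rho$ iff $M\models\rho$, for $M\in\mathit{Mod}(\varphi)M'$, $\rho\in\mathrm{dom}\,\mathit{Sen}(\varphi)$). A theory is $(\Sigma,E)$,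 $E\subseteq\mathit{Sen}(\Sigma)$; $E^\bullet$ is the set of $\Sigma$-sentences satisfied by every $\Sigma$-model of $E$. A signature morphism $\varphi:\Sigma\to\Sigma'$ is a weak theory morphism $(\Sigma,E)\to(\Sigma',E')$ if $\mathit{Sen}(\varphi)E^\bullet\subseteq E'^\bullet$, and a strong one if every $\Sigma'$-model $M'\models E'$ has some $M\in\mathit{Mod}(\varphi)M'$ with $M\models E$. -}

module Defs where

open import Level using (Level; _⊔_) renaming (suc to lsuc)
open import Data.Product using (Σ; Σ-syntax; ∃; _×_; _,_; proj₁; proj₂)
open import Data.Sum using (_⊎_)
open import Relation.Binary.PropositionalEquality using (_≡_)
open import Function.Bundles using (_⇔_)

-- The "data" of a 3/2-institution: carriers and the operations that
-- are determined independently of the signature category's identities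
-- and composition.  Composition is diagrammatic throughout.
--  * partial functions Sen(φ) are given by their graphs SenR φ
--    (single-valuedness is a law below);
--  * Mod(φ) is given on objects by ModFun φ M' M  ("M ∈ Mod(φ)M'") and
--    on arrows by ModArr φ h' h  ("h ∈ Mod(φ)h'").
record Data (o ℓ : Level) : Set (lsuc (o ⊔ ℓ)) where
  field
    Obj     : Set o
    Hom     : Obj → Obj → Set ℓ
    _≤_     : ∀ {A B} → Hom A B → Hom A B → Set ℓ
    Sen     : Obj → Set ℓ
    SenR    : ∀ {A B} → Hom A B → Sen A → Sen B → Set ℓ
    ModObj  : Obj → Set ℓ
    ModHom  : ∀ A → ModObj A → ModObj A → Set ℓ
    modId   : ∀ {A} (M : ModObj A) → ModHom A M M
    modComp : ∀ {A} {M N P : ModObj A} → ModHom A M N → ModHom A N P → ModHom A M P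
    ModFun  : ∀ {A B} → Hom A B → ModObj B → ModObj A → Set ℓ
    ModArr  : ∀ {A B} (φ : Hom A B) {M' N' : ModObj B} {M N : ModObj A} →
              ModHom B M' N' → ModHom A M N → Set ℓ
    _⊨_     : ∀ {A} → ModObj A → Sen A → Set ℓ

module _ {o ℓ : Level} (D : Data o ℓ) where
  open Data D

  SenLax : (idS : ∀ {A} → Hom A A) →
           (_⨾_ : ∀ {A B C} → Hom A B → Hom B C → Hom A C) → Set (o ⊔ ℓ)
  SenLax idS _⨾_ =
    (∀ {A B C} {φ : Hom A B} {ψ : Hom B C} {ρ ρ' ρ''} →
       SenR φ ρ ρ' → SenR ψ ρ' ρ'' → SenR (φ ⨾ ψ) ρ ρ'')
    × (∀ {A} {ρ : Sen A} → SenR idS ρ ρ)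

  SenOplax : (idS : ∀ {A} → Hom A A) →
             (_⨾_ : ∀ {A B C} → Hom A B → Hom B C → Hom A C) → Set (o ⊔ ℓ)
  SenOplax idS _⨾_ =
    (∀ {A B C} {φ : Hom A B} {ψ : Hom B C} {ρ ρ''} →
       SenR (φ ⨾ ψ) ρ ρ'' → ∃ λ ρ' → SenR φ ρ ρ' × SenR ψ ρ' ρ'')
    × (∀ {A} {ρ ρ' : Sen A} → SenR idS ρ ρ' → ρ ≡ ρ')

record IsThreeHalfInstitution {o ℓ : Level} (D : Data o ℓ) : Set (o ⊔ ℓ) where
  open Data D
  infixl 5 _⨾_
  field
    idS       : ∀ {A} → Hom A A
    _⨾_       : ∀ {A B C} → Hom A B → Hom B C → Hom A C
    identityˡ : ∀ {A B} (f : Hom A B) → idS ⨾ f ≡ f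
    identityʳ : ∀ {A B} (f : Hom A B) → f ⨾ idS ≡ f
    assoc     : ∀ {A B C E} (f : Hom A B) (g : Hom B C) (h : Hom C E) →
                (f ⨾ g) ⨾ h ≡ f ⨾ (g ⨾ h)
    ≤-refl    : ∀ {A B} {f : Hom A B} → f ≤ f
    ≤-trans   : ∀ {A B} {f g h : Hom A B} → f ≤ g → g ≤ h → f ≤ h
    ≤-antisym : ∀ {A B} {f g : Hom A B} → f ≤ g → g ≤ f → f ≡ g
    ⨾-mono    : ∀ {A B C} {f f' : Hom A B} {g g' : Hom B C} →
                f ≤ f' → g ≤ g' → (f ⨾ g) ≤ (f' ⨾ g')
    senR-functional : ∀ {A B} {φ : Hom A B} {ρ ρ₁ ρ₂} →
                      SenR φ ρ ρ₁ → SenR φ ρ ρ₂ → ρ₁ ≡ ρ₂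
    senR-mono : ∀ {A B} {φ θ : Hom A B} {ρ ρ'} → φ ≤ θ → SenR φ ρ ρ' → SenR θ ρ ρ'
    senLaxity : SenLax D idS _⨾_ ⊎ SenOplax D idS _⨾_
    mod-identityˡ : ∀ {A} {M N : ModObj A} (h : ModHom A M N) → modComp (modId M) h ≡ h
    mod-identityʳ : ∀ {A} {M N : ModObj A} (h : ModHom A M N) → modComp h (modId N) ≡ h
    mod-assoc : ∀ {A} {M N P Q : ModObj A}
                (h : ModHom A M N) (g : ModHom A N P) (k : ModHom A P Q) →
                modComp (modComp h g) k ≡ modComp h (modComp g k)
    -- Mod(φ) is a lax functor Mod(B) → power category of Mod(A)
    modArr-endpoints : ∀ {A B} {φ : Hom A B} {M' N' : ModObj B} {M N : ModObj A}
                       {h' : ModHom B M' N'} {h : ModHom A M N} →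
                       ModArr φ h' h → ModFun φ M' M × ModFun φ N' N
    modArr-id   : ∀ {A B} {φ : Hom A B} {M' : ModObj B} {M : ModObj A} →
                  ModFun φ M' M → ModArr φ (modId M') (modId M)
    modArr-comp : ∀ {A B} {φ : Hom A B} {M' N' P' : ModObj B} {M N P : ModObj A}
                  {h' : ModHom B M' N'} {g' : ModHom B N' P'}
                  {h : ModHom A M N} {g : ModHom A N P} →
                  ModArr φ h' h → ModArr φ g' g → ModArr φ (modComp h' g') (modComp h g)
    modFun-mono : ∀ {A B} {φ θ : Hom A B} {M' M} → φ ≤ θ → ModFun θ M' M → ModFun φ M' M
    modFun-comp : ∀ {A B C} {φ : Hom A B} {ψ : Hom B C} {M'' M' M} →
                  ModFun ψ M'' M' → ModFun φ M' M → ModFun (φ ⨾ ψ) M'' M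
    modFun-id   : ∀ {A} {M : ModObj A} → ModFun idS M M
    satisfaction : ∀ {A B} {φ : Hom A B} {M' : ModObj B} {M : ModObj A} {ρ ρ'} →
                   ModFun φ M' M → SenR φ ρ ρ' → (M' ⊨ ρ') ⇔ (M ⊨ ρ)

data Kind : Set where
  w s : Kind

module _ {o ℓ : Level} (D : Data o ℓ) where
  open Data D

  Theory : Set (o ⊔ lsuc ℓ)
  Theory = Σ Obj (λ A → Sen A → Set ℓ)

  _⊨*_ : ∀ {A} → ModObj A → (Sen A → Set ℓ) → Set ℓ
  M ⊨* E = ∀ ρ → E ρ → M ⊨ ρ

  closure : ∀ {A} → (Sen A → Set ℓ) → Sen A → Set ℓ
  closure {A} E ρ = (M : ModObj A) → M ⊨* E → M ⊨ ρ

  IsWeak : (T T' : Theory) → Hom (proj₁ T) (proj₁ T') → Set ℓ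
  IsWeak (A , E) (B , E') φ = ∀ ρ ρ' → closure E ρ → SenR φ ρ ρ' → closure E' ρ'

  IsStrong : (T T' : Theory) → Hom (proj₁ T) (proj₁ T') → Set ℓ
  IsStrong (A , E) (B , E') φ =
    (M' : ModObj B) → M' ⊨* E' → Σ (ModObj A) (λ M → ModFun φ M' M × M ⊨* E)

  IsThMor : Kind → (T T' : Theory) → Hom (proj₁ T) (proj₁ T') → Set ℓ
  IsThMor w = IsWeak
  IsThMor s = IsStrong

  record ThMor (i : Kind) (T T' : Theory) : Set ℓ where
    constructor thMor
    field
      mor    : Hom (proj₁ T) (proj₁ T')
      .isMor : IsThMor i T T' mor

  open ThMor public

  Th : Kind → Data (o ⊔ lsuc ℓ) ℓ
  Th i = record
    { Obj     = Theory
    ; Hom     = ThMor i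
    ; _≤_     = λ f g → mor f ≤ mor g
    ; Sen     = λ T → Sen (proj₁ T)
    ; SenR    = λ f → SenR (mor f)
    ; ModObj  = λ T → Σ (ModObj (proj₁ T)) (λ M → M ⊨* proj₂ T)
    ; ModHom  = λ T M N → ModHom (proj₁ T) (proj₁ M) (proj₁ N)
    ; modId   = λ M → modId (proj₁ M)
    ; modComp = modComp
    ; ModFun  = λ f M' M → ModFun (mor f) (proj₁ M') (proj₁ M)
    ; ModArr  = λ f h' h → ModArr (mor f) h' h
    ; _⊨_     = λ M ρ → proj₁ M ⊨ ρ
    }

Inherits : ∀ {o ℓ} (D : Data o ℓ) (I : IsThreeHalfInstitution D) (i : Kind) →
           IsThreeHalfInstitution (Th D i) → Set (o ⊔ lsuc ℓ)
Inherits D I i J =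
  (∀ {T} → mor (J.idS {T}) ≡ I.idS)
  × (∀ {T T' T''} (f : ThMor D i T T') (g : ThMor D i T' T'') →
       mor (f J.⨾ g) ≡ (mor f I.⨾ mor g))
  where
    module I = IsThreeHalfInstitution I
    module J = IsThreeHalfInstitution J

-- Every component of I_i except the signature category is copied from I:
-- sentences, model categories, Mod on objects and arrows and satisfaction
-- of I_i are those of I read through the first projections, so each law of
-- I_i is literally the corresponding law of I.  The only real work is to
-- show that theory morphisms of kind i form a category, i.e. that the
-- identity 1_Σ and the composite φ;ψ of theory morphisms are again theory
-- morphisms:
--   * strong morphisms are closed under identities and composition because
--     Mod is lax (M ∈ Mod(1)M, and Mod(ψ) followed by Mod(φ) lands in
--     Mod(φ;ψ));
--   * weak morphisms need the reverse inclusions on Sen, i.e. oplaxity: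
--     Sen(1) ⊆ 1 and Sen(φ;ψ) ⊆ Sen(φ);Sen(ψ).
-- Since theory morphisms carry their property irrelevantly, equality of
-- theory morphisms is equality of the underlying signature morphisms, which
-- gives the category laws and antisymmetry of the order.
module Submission where

open import Defs
open import Level using (_⊔_)
open import Data.Product using (Σ-syntax; ∃; _,_; proj₁; proj₂; _×_)
open import Data.Sum using (_⊎_; inj₁; inj₂)
open import Relation.Binary.PropositionalEquality using (_≡_; refl; subst)

module TheoryInstitution {o ℓ} (D : Data o ℓ) (I : IsThreeHalfInstitution D) where
  open Data D
  open IsThreeHalfInstitution I

  weak-identity : ∀ {A} (E : Sen A → Set ℓ) →
                  (∀ {ρ ρ'} → SenR (idS {A}) ρ ρ' → ρ ≡ ρ') →
                  IsWeak D (A , E) (A , E) idS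
  weak-identity E senId⊆id ρ ρ' ρ∈E• ρ↦ρ' = subst (closure D E) (senId⊆id ρ↦ρ') ρ∈E•

  strong-identity : (T : Theory D) → IsStrong D T T idS
  strong-identity T M' M'⊨E = M' , modFun-id , M'⊨E

  weak-composite : ∀ T T' T'' {f : Hom (proj₁ T) (proj₁ T')} {g : Hom (proj₁ T') (proj₁ T'')} →
                   (∀ {ρ ρ''} → SenR (f ⨾ g) ρ ρ'' → ∃ λ ρ' → SenR f ρ ρ' × SenR g ρ' ρ'') →
                   IsWeak D T T' f → IsWeak D T' T'' g → IsWeak D T T'' (f ⨾ g)
  weak-composite _ _ _ senComp⊆ f-weak g-weak ρ ρ'' ρ∈E• ρ↦ρ''
    with senComp⊆ ρ↦ρ''
  ... | ρ' , ρ↦ρ' , ρ'↦ρ'' = g-weak ρ' ρ'' (f-weak ρ ρ' ρ∈E• ρ↦ρ') ρ'↦ρ''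

  strong-composite : ∀ T T' T'' {f : Hom (proj₁ T) (proj₁ T')} {g : Hom (proj₁ T') (proj₁ T'')} →
                     IsStrong D T T' f → IsStrong D T' T'' g → IsStrong D T T'' (f ⨾ g)
  strong-composite _ _ _ f-strong g-strong M'' M''⊨E''
    with g-strong M'' M''⊨E''
  ... | M' , M'∈ModgM'' , M'⊨E' with f-strong M' M'⊨E'
  ... | M , M∈ModfM' , M⊨E = M , modFun-comp M'∈ModgM'' M∈ModfM' , M⊨E

  OplaxIfWeak : Kind → Set (o ⊔ ℓ)
  OplaxIfWeak i = i ≡ w → SenOplax D idS _⨾_

  identity-isThMor : ∀ i → OplaxIfWeak i → ∀ T → IsThMor D i T T idS
  identity-isThMor w oplax (A , E) = weak-identity E (proj₂ (oplax refl))
  identity-isThMor s _     T       = strong-identity T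

  composite-isThMor : ∀ i → OplaxIfWeak i → ∀ T T' T''
                      {f : Hom (proj₁ T) (proj₁ T')} {g : Hom (proj₁ T') (proj₁ T'')} →
                      IsThMor D i T T' f → IsThMor D i T' T'' g → IsThMor D i T T'' (f ⨾ g)
  composite-isThMor w oplax = λ T T' T'' → weak-composite T T' T'' (proj₁ (oplax refl))
  composite-isThMor s _     = strong-composite

  thMor-ext : ∀ {i T T'} {f g : ThMor D i T T'} → mor f ≡ mor g → f ≡ g
  thMor-ext {f = thMor _ _} {g = thMor _ _} refl = refl

  theoryInstitution : ∀ i → OplaxIfWeak i → IsThreeHalfInstitution (Th D i)
  theoryInstitution i oplax = record
    { idS              = identity
    ; _⨾_              = λ {T} {T'} {T''} → compose {T} {T'} {T''}
    ; identityˡ        = λ f → thMor-ext (identityˡ (mor f))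
    ; identityʳ        = λ f → thMor-ext (identityʳ (mor f))
    ; assoc            = λ f g h → thMor-ext (assoc (mor f) (mor g) (mor h))
    ; ≤-refl           = ≤-refl
    ; ≤-trans          = ≤-trans
    ; ≤-antisym        = λ f≤g g≤f → thMor-ext (≤-antisym f≤g g≤f)
    ; ⨾-mono           = ⨾-mono
    ; senR-functional  = senR-functional
    ; senR-mono        = senR-mono
    ; senLaxity        = laxity-of-theories senLaxity
    ; mod-identityˡ    = mod-identityˡ
    ; mod-identityʳ    = mod-identityʳ
    ; mod-assoc        = mod-assoc
    ; modArr-endpoints = modArr-endpoints
    ; modArr-id        = modArr-id
    ; modArr-comp      = modArr-comp
    ; modFun-mono      = modFun-mono
    ; modFun-comp      = modFun-comp
    ; modFun-id        = modFun-id
    ; satisfaction     = satisfaction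
    }
    where
    compose : ∀ {T T' T''} → ThMor D i T T' → ThMor D i T' T'' → ThMor D i T T''
    compose {T} {T'} {T''} (thMor f f-isMor) (thMor g g-isMor) =
      thMor (f ⨾ g) (composite-isThMor i oplax T T' T'' f-isMor g-isMor)

    identity : ∀ {T} → ThMor D i T T
    identity {T} = thMor idS (identity-isThMor i oplax T)

    -- The lax/oplax laws of Sen mention only the underlying signature
    -- morphisms, so they hold verbatim for theory morphisms (the types
    -- differ only in the universe level of the enclosing product).
    laxity-of-theories : SenLax D idS _⨾_ ⊎ SenOplax D idS _⨾_ →
                         SenLax (Th D i) identity compose ⊎ SenOplax (Th D i) identity compose
    laxity-of-theories (inj₁ (lax-comp , lax-id))     = inj₁ (lax-comp , lax-id)
    laxity-of-theories (inj₂ (oplax-comp , oplax-id)) = inj₂ (oplax-comp , oplax-id)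

mainTheorem9 : ∀ {o ℓ} (D : Data o ℓ) (I : IsThreeHalfInstitution D) (i : Kind) →
    (i ≡ w → SenOplax D (IsThreeHalfInstitution.idS I) (IsThreeHalfInstitution._⨾_ I)) →
    Σ[ J ∈ IsThreeHalfInstitution (Th D i) ] Inherits D I i J
mainTheorem9 D I i oplax =
  TheoryInstitution.theoryInstitution D I i oplax , refl , λ _ _ → refl
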